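{- Let $p$ be a prime. A nonnegative integer $n$ is a binomial predictor in base $p$ if and only if $n$ is a Zumkeller's number in base $p$.
   Context: For a prime $p$ and nonnegative integers $n,k$, let $A_{n,k}^{(p)}=\{x\in\{0,1,\dots,n\}:\ p^k\,\|\,\binom{n}{x}\}$, where $p^k\,\|\,N$ means $p^k\mid N$ and $p^{k+1}\nmid N$. Let the expansion of $n+1$ in base $p$ be $n+1=\alpha_0p^{\nu}+\alpha_1p^{\nu-1}+\dots+\alpha_{\nu}$ with $0\le\alpha_i\le p-1$ for $i=0,\dots,\nu$ (and $\alpha_0\neq 0$). The number $n$ is called a binomial predictor in base $p$ if $|A_{n,k}^{(p)}|=\alpha_kp^{\nu-k}$ for all $k=0,1,\dots,\nu$. A nonnegative integer $n$ is called a Zumkeller's number in base $p$ if either $n=0$ or its expansion in base $p$ has all digits equal to $p-1$ except possibly one digit; if this exceptional digit is the first (leading) digit (which can occur only when $p\ge 3$), it may take any value in $\{1,\dots,p-2\}$; if the exceptional digit is in any other position, it must equal $p-2$. -}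

module Defs where

open import Data.Nat using (ℕ; zero; suc; _+_; _*_; _∸_; _^_; _≤_; _<_)
open import Data.Nat.Divisibility using (_∣_; _∣?_)
open import Data.Nat.Combinatorics using (_C_)
open import Data.List using (List; []; _∷_; length; filter; upTo; foldl; lookup)
open import Data.List.Relation.Unary.All using (All)
open import Data.Fin using (Fin; toℕ)
open import Data.Product using (_×_; Σ; ∃; ∃-syntax)
open import Data.Sum using (_⊎_)
open import Relation.Nullary using (¬_)
open import Relation.Nullary.Decidable using (_×-dec_; ¬?)
open import Relation.Binary.PropositionalEquality using (_≡_; _≢_)

_^_∥_ : ℕ → ℕ → ℕ → Set
p ^ k ∥ N = (p ^ k ∣ N) × ¬ (p ^ suc k ∣ N)

cardA : ℕ → ℕ → ℕ → ℕ
cardA p n k =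
  length (filter (λ x → (p ^ k ∣? (n C x)) ×-dec ¬? (p ^ suc k ∣? (n C x))) (upTo (suc n)))

evalDigits : ℕ → List ℕ → ℕ
evalDigits p = foldl (λ acc d → acc * p + d) 0

-- ds = (α₀, …, α_ν) is the base-p expansion of m (most significant first,
-- leading digit nonzero, all digits < p).  For m ≥ 1 this exists and is unique.
IsExpansion : ℕ → ℕ → List ℕ → Set
IsExpansion p m ds =
  All (λ d → d < p) ds × (Σ (0 < length ds) λ h → 1 ≤ lookup ds (Data.Fin.fromℕ< h))
  × evalDigits p ds ≡ m

BinomialPredictor : ℕ → ℕ → Set
BinomialPredictor p n =
  ∃[ ds ] IsExpansion p (suc n) ds ×
    ((k : Fin (length ds)) → cardA p n (toℕ k) ≡ lookup ds k * p ^ (length ds ∸ suc (toℕ k)))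

Zumkeller : ℕ → ℕ → Set
Zumkeller p n =
  n ≡ 0 ⊎
  (∃[ ds ] IsExpansion p n ds ×
    ( ((k : Fin (length ds)) → lookup ds k ≡ p ∸ 1)
    ⊎ (∃[ i ] ( ((k : Fin (length ds)) → k ≢ i → lookup ds k ≡ p ∸ 1)
              × ( (toℕ i ≡ 0 × 1 ≤ lookup ds i × lookup ds i ≤ p ∸ 2)
                ⊎ (1 ≤ toℕ i × lookup ds i ≡ p ∸ 2))))))

{-# OPTIONS --safe #-}
module Submission where

-- Let v be the p-adic valuation and countA n k = |A_{n,k}|. By Legendre's formula (Kummer's
-- carries), v C(pm+r, pa+b) is v C(m, a) when b ≤ r and 1 + v m + v C(m-1, a) when b > r; hence
-- countA (pm+r) k = (r+1) countA m k + (p-1-r) · #{a < m : 1 + v m + v C(m-1, a) = k}.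
-- Unfolding this recurrence along the digits computes countA for n + 1 = c p^L (0 < c < p) and
-- for n + 1 = (p^(M+1) - 1) p^j (M ≥ 1), which are exactly the successors of Zumkeller numbers,
-- and these counts are the ones predicted by the digits of n + 1. Conversely only the prediction
-- for k = 0 is needed: strip the trailing digits p - 1 of n; if the next digit r is not the
-- leading one, then (r+1) countA m 0 = α₀ p^L with p ∤ r+1 and countA m 0 ≤ m + 1 ≤ p^L force
-- m + 1 = p^L and r + 1 = α₀, and the bound n + 1 < (α₀ + 1) p^(L+1) forces α₀ = p - 1.

open import Defs
open import Data.Nat
open import Data.Nat.Properties
open import Data.Nat.Tactic.RingSolver using (solve-∀)
open import Data.List using (List; []; _∷_; length; filter; applyUpTo; foldl; lookup; replicate)
open import Data.List.Properties using (length-replicate)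
open import Data.List.Relation.Unary.All using (All; []; _∷_)
open import Data.List.Relation.Unary.All.Properties using (replicate⁺)
open import Data.Fin using (Fin; zero; suc; toℕ)
open import Data.Fin.Properties using (toℕ<n) renaming (suc-injective to fsuc-injective)
open import Data.Product using (_×_; _,_; proj₁; proj₂; ∃-syntax)
open import Function using (_∘_)
open import Function.Bundles using (_⇔_; mk⇔)
open import Relation.Binary.PropositionalEquality
open import Relation.Nullary using (¬_; yes; no; contradiction)
open import Relation.Unary using (Decidable)
open import Relation.Nullary.Decidable using (_×-dec_; ¬?)
open import Data.Nat.Divisibility
open import Data.Nat.DivMod using (_/_; _%_; m*n/n≡m; m/n*n≡m; m≡m%n+[m/n]*n; m%n<n)
open import Data.Nat.Combinatorics using (_C_; k![n∸k]!∣n!)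
open import Data.Nat.Combinatorics.Specification using (nCk≡n!/k![n-k]!)
open import Data.Nat.Primality using (Prime; euclidsLemma; prime⇒nonZero; prime⇒nonTrivial)
open import Data.Sum using (inj₁; inj₂)
open import Relation.Binary.Definitions using (tri<; tri≈; tri>)

*-left-comm : ∀ a b c → a * (b * c) ≡ b * (a * c)
*-left-comm = solve-∀

lookup-replicate′ : ∀ {A : Set} L (x : A) (k : Fin (length (replicate L x))) → lookup (replicate L x) k ≡ x
lookup-replicate′ (suc L) x zero    = refl
lookup-replicate′ (suc L) x (suc k) = lookup-replicate′ L x k

sumBelow : (ℕ → ℕ) → ℕ → ℕ
sumBelow f zero    = 0
sumBelow f (suc N) = f 0 + sumBelow (f ∘ suc) N

sumBelow-cong : ∀ N {f g : ℕ → ℕ} → (∀ x → x < N → f x ≡ g x) → sumBelow f N ≡ sumBelow g N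
sumBelow-cong zero    f≗g = refl
sumBelow-cong (suc N) f≗g = cong₂ _+_ (f≗g 0 z<s) (sumBelow-cong N (λ x x<N → f≗g (suc x) (s<s x<N)))

sumBelow-+ : ∀ M N (f : ℕ → ℕ) → sumBelow f (M + N) ≡ sumBelow f M + sumBelow (λ x → f (M + x)) N
sumBelow-+ zero    N f = refl
sumBelow-+ (suc M) N f = trans (cong (f 0 +_) (sumBelow-+ M N (f ∘ suc))) (sym (+-assoc (f 0) _ _))

sumBelow-distrib : ∀ N (f g : ℕ → ℕ) → sumBelow (λ x → f x + g x) N ≡ sumBelow f N + sumBelow g N
sumBelow-distrib zero    f g = refl
sumBelow-distrib (suc N) f g =
  trans (cong (f 0 + g 0 +_) (sumBelow-distrib N (f ∘ suc) (g ∘ suc)))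
        (interchange (f 0) (g 0) _ _)
  where
  interchange : ∀ a b c d → a + b + (c + d) ≡ a + c + (b + d)
  interchange = solve-∀

sumBelow-const : ∀ N c → sumBelow (λ _ → c) N ≡ N * c
sumBelow-const zero    c = refl
sumBelow-const (suc N) c = cong (c +_) (sumBelow-const N c)

sumBelow-sucʳ : ∀ N (f : ℕ → ℕ) → sumBelow f (suc N) ≡ sumBelow f N + f N
sumBelow-sucʳ N f = begin
  sumBelow f (suc N)                        ≡⟨ cong (sumBelow f) (+-comm 1 N) ⟩
  sumBelow f (N + 1)                        ≡⟨ sumBelow-+ N 1 f ⟩
  sumBelow f N + (f (N + 0) + 0)            ≡⟨ cong (λ y → sumBelow f N + y) (+-identityʳ _) ⟩
  sumBelow f N + f (N + 0)                  ≡⟨ cong (λ y → sumBelow f N + f y) (+-identityʳ N) ⟩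
  sumBelow f N + f N                        ∎
  where open ≡-Reasoning

sumBelow-* : ∀ q m (f : ℕ → ℕ) → sumBelow f (q * m) ≡ sumBelow (λ a → sumBelow (λ b → f (q * a + b)) q) m
sumBelow-* q zero    f = cong (sumBelow f) (*-zeroʳ q)
sumBelow-* q (suc m) f = begin
  sumBelow f (q * suc m)
    ≡⟨ cong (sumBelow f) (*-suc q m) ⟩
  sumBelow f (q + q * m)
    ≡⟨ sumBelow-+ q (q * m) f ⟩
  sumBelow f q + sumBelow (λ x → f (q + x)) (q * m)
    ≡⟨ cong₂ _+_ (sumBelow-cong q (λ b _ → cong (λ y → f (y + b)) (sym (*-zeroʳ q))))
                 (sumBelow-* q m (λ x → f (q + x))) ⟩
  sumBelow (λ b → f (q * 0 + b)) q + sumBelow (λ a → sumBelow (λ b → f (q + (q * a + b))) q) m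
    ≡⟨ cong (sumBelow (λ b → f (q * 0 + b)) q +_)
            (sumBelow-cong m (λ a _ → sumBelow-cong q (λ b _ → cong f (shift a b)))) ⟩
  sumBelow (λ a → sumBelow (λ b → f (q * a + b)) q) (suc m)
    ∎
  where
  open ≡-Reasoning
  shift : ∀ a b → q + (q * a + b) ≡ q * suc a + b
  shift a b = trans (sym (+-assoc q (q * a) b)) (cong (_+ b) (sym (*-suc q a)))

sumBelow-comm : ∀ m q (h : ℕ → ℕ → ℕ) →
  sumBelow (λ a → sumBelow (h a) q) m ≡ sumBelow (λ b → sumBelow (λ a → h a b) m) q
sumBelow-comm zero    q h = sym (trans (sumBelow-const q 0) (*-zeroʳ q))
sumBelow-comm (suc m) q h =
  trans (cong (sumBelow (h 0) q +_) (sumBelow-comm m q (h ∘ suc)))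
        (sym (sumBelow-distrib q (h 0) (λ b → sumBelow (λ a → h (suc a) b) m)))

sumBelow-≤ : ∀ N (f : ℕ → ℕ) → (∀ x → f x ≤ 1) → sumBelow f N ≤ N
sumBelow-≤ zero    f f≤1 = z≤n
sumBelow-≤ (suc N) f f≤1 = +-mono-≤ (f≤1 0) (sumBelow-≤ N (f ∘ suc) (f≤1 ∘ suc))

δ : ℕ → ℕ → ℕ
δ zero    zero    = 1
δ zero    (suc b) = 0
δ (suc a) zero    = 0
δ (suc a) (suc b) = δ a b

δ-refl : ∀ a → δ a a ≡ 1
δ-refl zero    = refl
δ-refl (suc a) = δ-refl a

δ-≢ : ∀ a b → a ≢ b → δ a b ≡ 0
δ-≢ zero    zero    a≢b = contradiction refl a≢b
δ-≢ zero    (suc b) a≢b = refl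
δ-≢ (suc a) zero    a≢b = refl
δ-≢ (suc a) (suc b) a≢b = δ-≢ a b (a≢b ∘ cong suc)

δ-≤1 : ∀ a b → δ a b ≤ 1
δ-≤1 zero    zero    = ≤-refl
δ-≤1 zero    (suc b) = z≤n
δ-≤1 (suc a) zero    = z≤n
δ-≤1 (suc a) (suc b) = δ-≤1 a b

length-filter-applyUpTo : ∀ {P : ℕ → Set} (P? : Decidable P) (h : ℕ → ℕ) N (χ : ℕ → ℕ) →
  (∀ x → x < N → (P (h x) → χ x ≡ 1) × (¬ P (h x) → χ x ≡ 0)) →
  length (filter P? (applyUpTo h N)) ≡ sumBelow χ N
length-filter-applyUpTo P? h zero    χ χ-spec = refl
length-filter-applyUpTo P? h (suc N) χ χ-spec
  with rest ← length-filter-applyUpTo P? (h ∘ suc) N (χ ∘ suc) (λ x x<N → χ-spec (suc x) (s<s x<N))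
     | P? (h 0)
... | yes Ph0 = cong₂ _+_ (sym (proj₁ (χ-spec 0 z<s) Ph0)) rest
... | no ¬Ph0 = cong₂ _+_ (sym (proj₂ (χ-spec 0 z<s) ¬Ph0)) rest

module _ (p : ℕ) (p-prime : Prime p) where

  -- p-adic valuation

  instance
    p≢0 : NonZero p
    p≢0 = prime⇒nonZero p-prime

  p>1 : 1 < p
  p>1 = nonTrivial⇒n>1 p {{prime⇒nonTrivial p-prime}}

  p∤1 : ¬ p ∣ 1
  p∤1 p∣1 = <⇒≢ p>1 (sym (∣1⇒≡1 p∣1))

  0<m*p⇒0<m : ∀ {m} → 0 < m * p → 0 < m
  0<m*p⇒0<m {zero}  ()
  0<m*p⇒0<m {suc m} _ = z<s

  0<m⇒m<m*p : ∀ {m} → 0 < m → m < m * p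
  0<m⇒m<m*p {m} m>0 = m<m*n m p {{>-nonZero m>0}} p>1

  -- Each step divides by p ≥ 2, so fuel N suffices to compute the p-adic valuation of N.
  valuationWithFuel : ℕ → ℕ → ℕ
  valuationWithFuel zero       N = 0
  valuationWithFuel (suc fuel) N with p ∣? N
  ... | yes _ = suc (valuationWithFuel fuel (N / p))
  ... | no  _ = 0

  v : ℕ → ℕ
  v N = valuationWithFuel N N

  valuationWithFuel-factor : ∀ fuel N → N ≤ fuel → 0 < N →
    ∃[ u ] ¬ p ∣ u × N ≡ p ^ valuationWithFuel fuel N * u
  valuationWithFuel-factor zero N N≤0 N>0 = contradiction N≤0 (<⇒≱ N>0)
  valuationWithFuel-factor (suc fuel) N N≤fuel N>0 with p ∣? N
  ... | no p∤N = N , p∤N , sym (*-identityˡ N)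
  ... | yes (divides-refl q)
    with u , p∤u , q≡p^i*u ← valuationWithFuel-factor fuel q
           (≤-pred (≤-trans (0<m⇒m<m*p (0<m*p⇒0<m N>0)) N≤fuel)) (0<m*p⇒0<m N>0) =
      u , p∤u , (begin
        q * p                   ≡⟨ cong (_* p) q≡p^i*u ⟩
        p ^ i * u * p           ≡⟨ rotate (p ^ i) u p ⟩
        p * p ^ i * u           ≡⟨ cong (λ j → p * p ^ valuationWithFuel fuel j * u) (sym (m*n/n≡m q p)) ⟩
        p * p ^ valuationWithFuel fuel (q * p / p) * u ∎)
    where
    open ≡-Reasoning
    i = valuationWithFuel fuel q
    rotate : ∀ a b c → a * b * c ≡ c * a * b
    rotate = solve-∀

  v-factor : ∀ N → 0 < N → ∃[ u ] ¬ p ∣ u × N ≡ p ^ v N * u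
  v-factor N = valuationWithFuel-factor N N ≤-refl

  p^-*-injectiveˡ : ∀ i j {u w} → ¬ p ∣ u → ¬ p ∣ w → p ^ i * u ≡ p ^ j * w → i ≡ j
  p^-*-injectiveˡ zero    zero    p∤u p∤w eq = refl
  p^-*-injectiveˡ zero    (suc j) p∤u p∤w eq =
    contradiction (subst (p ∣_) (trans (sym eq) (*-identityˡ _)) (∣m⇒∣m*n _ (m∣m*n (p ^ j)))) p∤u
  p^-*-injectiveˡ (suc i) zero    p∤u p∤w eq = sym (p^-*-injectiveˡ zero (suc i) p∤w p∤u (sym eq))
  p^-*-injectiveˡ (suc i) (suc j) p∤u p∤w eq = cong suc (p^-*-injectiveˡ i j p∤u p∤w
    (*-cancelˡ-≡ _ _ p (trans (sym (*-assoc p (p ^ i) _)) (trans eq (*-assoc p (p ^ j) _)))))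

  p∤⇒>0 : ∀ {u} → ¬ p ∣ u → 0 < u
  p∤⇒>0 {zero}  p∤0 = contradiction (p ∣0) p∤0
  p∤⇒>0 {suc u} _   = z<s

  v-p^*p∤ : ∀ i {u} → ¬ p ∣ u → v (p ^ i * u) ≡ i
  v-p^*p∤ i {u} p∤u with w , p∤w , eq ← v-factor (p ^ i * u) (*-mono-< (m^n>0 p i) (p∤⇒>0 p∤u)) =
    p^-*-injectiveˡ _ i p∤w p∤u (sym eq)

  v-p∤ : ∀ {u} → ¬ p ∣ u → v u ≡ 0
  v-p∤ {u} p∤u = trans (cong v (sym (*-identityˡ u))) (v-p^*p∤ 0 p∤u)

  v-p^ : ∀ i → v (p ^ i) ≡ i
  v-p^ i = trans (cong v (sym (*-identityʳ (p ^ i)))) (v-p^*p∤ i p∤1)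

  v-p : v p ≡ 1
  v-p = trans (cong v (sym (*-identityʳ p))) (v-p^ 1)

  v-* : ∀ {a b} → 0 < a → 0 < b → v (a * b) ≡ v a + v b
  v-* {a} {b} a>0 b>0
    with u , p∤u , a≡ ← v-factor a a>0 | w , p∤w , b≡ ← v-factor b b>0 = begin
      v (a * b)                          ≡⟨ cong v (cong₂ _*_ a≡ b≡) ⟩
      v (p ^ i * u * (p ^ j * w))        ≡⟨ cong v (regroup (p ^ i) (p ^ j) u w) ⟩
      v (p ^ i * p ^ j * (u * w))        ≡⟨ cong (λ x → v (x * (u * w))) (sym (^-distribˡ-+-* p i j)) ⟩
      v (p ^ (i + j) * (u * w))          ≡⟨ v-p^*p∤ (i + j) p∤uw ⟩
      i + j                              ∎
    where
    open ≡-Reasoning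
    i = v a
    j = v b
    regroup : ∀ x y z t → x * z * (y * t) ≡ x * y * (z * t)
    regroup = solve-∀
    p∤uw : ¬ p ∣ u * w
    p∤uw p∣uw with euclidsLemma u w p-prime p∣uw
    ... | inj₁ p∣u = p∤u p∣u
    ... | inj₂ p∣w = p∤w p∣w

  p^∣p^* : ∀ {k i} u → k ≤ i → p ^ k ∣ p ^ i * u
  p^∣p^* {k} {i} u k≤i = ∣m⇒∣m*n u (divides (p ^ (i ∸ k)) (begin
    p ^ i                  ≡⟨ cong (p ^_) (sym (m∸n+n≡m k≤i)) ⟩
    p ^ (i ∸ k + k)        ≡⟨ ^-distribˡ-+-* p (i ∸ k) k ⟩
    p ^ (i ∸ k) * p ^ k    ∎))
    where open ≡-Reasoning

  p^suc∤p^*p∤ : ∀ i {u} → ¬ p ∣ u → ¬ p ^ suc i ∣ p ^ i * u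
  p^suc∤p^*p∤ i {u} p∤u p^suc∣ =
    p∤u (*-cancelˡ-∣ (p ^ i) {{m^n≢0 p i}} (subst (_∣ p ^ i * u) (*-comm p (p ^ i)) p^suc∣))

  ∥⇒v≡ : ∀ {N k} → 0 < N → p ^ k ∥ N → v N ≡ k
  ∥⇒v≡ {N} {k} N>0 (p^k∣N , p^sk∤N) with u , p∤u , N≡ ← v-factor N N>0 with <-cmp k (v N)
  ... | tri< k<i _ _ = contradiction (subst (p ^ suc k ∣_) (sym N≡) (p^∣p^* u k<i)) p^sk∤N
  ... | tri≈ _ k≡i _ = sym k≡i
  ... | tri> _ _ i<k = contradiction
          (∣-trans (subst (_ ∣_) (*-identityʳ (p ^ k)) (p^∣p^* 1 i<k)) (subst (p ^ k ∣_) N≡ p^k∣N))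
          (p^suc∤p^*p∤ (v N) p∤u)

  v≡⇒∥ : ∀ {N k} → 0 < N → v N ≡ k → p ^ k ∥ N
  v≡⇒∥ {N} N>0 refl with u , p∤u , N≡ ← v-factor N N>0 =
    subst (p ^ v N ∣_) (sym N≡) (p^∣p^* {v N} u ≤-refl) ,
    subst (λ M → ¬ p ^ suc (v N) ∣ M) (sym N≡) (p^suc∤p^*p∤ (v N) p∤u)

  ≤v⇒∣ : ∀ {N k} → 0 < N → k ≤ v N → p ^ k ∣ N
  ≤v⇒∣ {N} {k} N>0 k≤v with u , p∤u , N≡ ← v-factor N N>0 = subst (p ^ k ∣_) (sym N≡) (p^∣p^* u k≤v)

  suc[p∸1]≡p : suc (p ∸ 1) ≡ p
  suc[p∸1]≡p = trans (+-comm 1 (p ∸ 1)) (m∸n+n≡m (<⇒≤ p>1))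

  p∸1<p : p ∸ 1 < p
  p∸1<p = subst (p ∸ 1 <_) suc[p∸1]≡p ≤-refl

  p∸1≥1 : 1 ≤ p ∸ 1
  p∸1≥1 = ≤-pred (subst (1 <_) (sym suc[p∸1]≡p) p>1)

  p*suc≡suc[p*+p∸1] : ∀ q → p * suc q ≡ suc (p * q + (p ∸ 1))
  p*suc≡suc[p*+p∸1] q = begin
    p * suc q               ≡⟨ *-suc p q ⟩
    p + p * q               ≡⟨ +-comm p (p * q) ⟩
    p * q + p               ≡⟨ cong (p * q +_) suc[p∸1]≡p ⟨
    p * q + suc (p ∸ 1)     ≡⟨ +-suc (p * q) (p ∸ 1) ⟩
    suc (p * q + (p ∸ 1))   ∎
    where open ≡-Reasoning

  -- Legendre's formula and Kummer's theorem

  v-suc! : ∀ n → v (suc n !) ≡ v (suc n) + v (n !)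
  v-suc! n = v-* z<s (1≤n! n)

  v[p*q+s]! : ∀ q s → s < p → v ((p * q + s) !) ≡ v ((p * q) !)
  v[p*q+s]! q zero    s<p = cong (v ∘ _!) (+-identityʳ (p * q))
  v[p*q+s]! q (suc s) s<p = begin
    v ((p * q + suc s) !)                          ≡⟨ cong (v ∘ _!) (+-suc (p * q) s) ⟩
    v (suc (p * q + s) !)                          ≡⟨ v-suc! (p * q + s) ⟩
    v (suc (p * q + s)) + v ((p * q + s) !)         ≡⟨ cong₂ _+_ (v-p∤ p∤) (v[p*q+s]! q s (<⇒≤ s<p)) ⟩
    v ((p * q) !)                                  ∎
    where
    open ≡-Reasoning
    p∤ : ¬ p ∣ suc (p * q + s)
    p∤ p∣ = <⇒≱ s<p (∣⇒≤ (∣m+n∣m⇒∣n (subst (p ∣_) (sym (+-suc (p * q) s)) p∣) (m∣m*n q)))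

  legendre : ∀ q s → s < p → v ((p * q + s) !) ≡ q + v (q !)
  legendre q s s<p = trans (v[p*q+s]! q s s<p) (v[p*q]! q)
    where
    v[p*q]! : ∀ q → v ((p * q) !) ≡ q + v (q !)
    v[p*q]! zero    = cong (v ∘ _!) (*-zeroʳ p)
    v[p*q]! (suc q) = begin
      v ((p * suc q) !)
        ≡⟨ cong (v ∘ _!) (p*suc≡suc[p*+p∸1] q) ⟩
      v (suc (p * q + (p ∸ 1)) !)
        ≡⟨ v-suc! (p * q + (p ∸ 1)) ⟩
      v (suc (p * q + (p ∸ 1))) + v ((p * q + (p ∸ 1)) !)
        ≡⟨ cong₂ _+_ (cong v (sym (p*suc≡suc[p*+p∸1] q))) (v[p*q+s]! q (p ∸ 1) p∸1<p) ⟩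
      v (p * suc q) + v ((p * q) !)
        ≡⟨ cong₂ _+_ (v-* (<-trans z<s p>1) z<s) (v[p*q]! q) ⟩
      v p + v (suc q) + (q + v (q !))
        ≡⟨ cong (λ x → x + v (suc q) + (q + v (q !))) v-p ⟩
      suc (v (suc q)) + (q + v (q !))
        ≡⟨ regroup (v (suc q)) q (v (q !)) ⟩
      suc q + (v (suc q) + v (q !))
        ≡⟨ cong (suc q +_) (v-suc! q) ⟨
      suc q + v (suc q !)
        ∎
      where
      open ≡-Reasoning
      regroup : ∀ a b c → suc a + (b + c) ≡ suc b + (a + c)
      regroup = solve-∀

  vC : ℕ → ℕ → ℕ
  vC n x = v (n C x)

  C*!*!≡! : ∀ {n x} → x ≤ n → (n C x) * (x ! * (n ∸ x) !) ≡ n !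
  C*!*!≡! {n} {x} x≤n = trans (cong (_* (x ! * (n ∸ x) !)) (nCk≡n!/k![n-k]! x≤n))
                              (m/n*n≡m {{x !* (n ∸ x) !≢0}} (k![n∸k]!∣n! x≤n))

  C>0 : ∀ {n x} → x ≤ n → 0 < n C x
  C>0 {n} {x} x≤n = n≢0⇒n>0 λ C≡0 →
    ≢-nonZero⁻¹ (n !) {{n !≢0}} (trans (sym (C*!*!≡! x≤n)) (cong (_* (x ! * (n ∸ x) !)) C≡0))

  vC+v!+v!≡v! : ∀ x y → vC (x + y) x + (v (x !) + v (y !)) ≡ v ((x + y) !)
  vC+v!+v!≡v! x y = begin
    vC (x + y) x + (v (x !) + v (y !))
      ≡⟨ cong (vC (x + y) x +_) (v-* (1≤n! x) (1≤n! y)) ⟨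
    vC (x + y) x + v (x ! * y !)
      ≡⟨ cong (λ z → vC (x + y) x + v (x ! * z !)) (m+n∸m≡n x y) ⟨
    vC (x + y) x + v (x ! * (x + y ∸ x) !)
      ≡⟨ v-* (C>0 (m≤m+n x y)) (*-mono-< (1≤n! x) (1≤n! (x + y ∸ x))) ⟨
    v (((x + y) C x) * (x ! * (x + y ∸ x) !))
      ≡⟨ cong v (C*!*!≡! (m≤m+n x y)) ⟩
    v ((x + y) !)
      ∎
    where open ≡-Reasoning

  vC-digits : ∀ {n} a b c e → b < p → e < p → n ≡ (p * a + b) + (p * c + e) →
    vC n (p * a + b) + (a + c + (v (a !) + v (c !))) ≡ v (n !)
  vC-digits a b c e b<p e<p refl = begin
    vC n x + (a + c + (v (a !) + v (c !)))
      ≡⟨ cong (vC n x +_) (regroup a c (v (a !)) (v (c !))) ⟩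
    vC n x + ((a + v (a !)) + (c + v (c !)))
      ≡⟨ cong (vC n x +_) (cong₂ _+_ (legendre a b b<p) (legendre c e e<p)) ⟨
    vC n x + (v (x !) + v (y !))
      ≡⟨ vC+v!+v!≡v! x y ⟩
    v (n !)
      ∎
    where
    open ≡-Reasoning
    x = p * a + b
    y = p * c + e
    n = x + y
    regroup : ∀ a c A C → a + c + (A + C) ≡ (a + A) + (c + C)
    regroup = solve-∀

  -- Kummer: no carry out of the last base-p digit.
  vC-no-carry : ∀ {m r a b} → a ≤ m → b ≤ r → r < p → vC (p * m + r) (p * a + b) ≡ vC m a
  vC-no-carry {m} {r} {a} {b} a≤m b≤r r<p
    with c , refl ← m≤n⇒∃[o]m+o≡n a≤m | e , refl ← m≤n⇒∃[o]m+o≡n b≤r =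
    +-cancelʳ-≡ K _ _ (begin
      vC n x + K
        ≡⟨ vC-digits a b c e (≤-<-trans (m≤m+n b e) r<p) (≤-<-trans (m≤n+m e b) r<p) (regroup p a c b e) ⟩
      v (n !)
        ≡⟨ legendre (a + c) (b + e) r<p ⟩
      a + c + v ((a + c) !)
        ≡⟨ cong (a + c +_) (vC+v!+v!≡v! a c) ⟨
      a + c + (vC (a + c) a + (v (a !) + v (c !)))
        ≡⟨ swap (a + c) (vC (a + c) a) (v (a !) + v (c !)) ⟩
      vC (a + c) a + K
        ∎)
    where
    open ≡-Reasoning
    n = p * (a + c) + (b + e)
    x = p * a + b
    K = a + c + (v (a !) + v (c !))
    regroup : ∀ p a c b e → p * (a + c) + (b + e) ≡ (p * a + b) + (p * c + e)
    regroup = solve-∀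
    swap : ∀ s V W → s + (V + W) ≡ V + (s + W)
    swap = solve-∀

  -- Kummer: a carry out of the last base-p digit.
  vC-carry : ∀ {m r a b} → a < m → r < b → b < p →
    vC (p * m + r) (p * a + b) ≡ suc (v m + vC (m ∸ 1) a)
  vC-carry {m} {r} {a} {b} a<m r<b b<p
    with c , refl ← m≤n⇒∃[o]m+o≡n a<m = +-cancelʳ-≡ K _ _ (begin
      vC n x + K
        ≡⟨ vC-digits a b c e b<p e<p n≡x+y ⟩
      v (n !)
        ≡⟨ legendre (suc (a + c)) r (<-trans r<b b<p) ⟩
      suc (a + c) + v (suc (a + c) !)
        ≡⟨ cong (suc (a + c) +_) (v-suc! (a + c)) ⟩
      suc (a + c) + (v (suc (a + c)) + v ((a + c) !))
        ≡⟨ cong (λ z → suc (a + c) + (v (suc (a + c)) + z)) (vC+v!+v!≡v! a c) ⟨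
      suc (a + c) + (v (suc (a + c)) + (vC (a + c) a + (v (a !) + v (c !))))
        ≡⟨ swap (a + c) (v (suc (a + c))) (vC (a + c) a) (v (a !) + v (c !)) ⟩
      suc (v (suc (a + c)) + vC (a + c) a) + K
        ∎)
    where
    open ≡-Reasoning
    n = p * (suc a + c) + r
    x = p * a + b
    e = (p ∸ b) + r
    K = a + c + (v (a !) + v (c !))
    e<p : e < p
    e<p = subst (e <_) (m∸n+n≡m (<⇒≤ b<p)) (+-monoʳ-< (p ∸ b) r<b)
    n≡x+y : n ≡ x + (p * c + e)
    n≡x+y = regroupAt (m+[n∸m]≡n (<⇒≤ b<p))
      where
      regroup : ∀ a c b d r → (b + d) * (suc a + c) + r ≡ ((b + d) * a + b) + ((b + d) * c + (d + r))
      regroup = solve-∀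
      regroupAt : ∀ {q} → b + (p ∸ b) ≡ q → q * (suc a + c) + r ≡ (q * a + b) + (q * c + ((p ∸ b) + r))
      regroupAt refl = regroup a c b (p ∸ b) r
    swap : ∀ s V W X → suc s + (V + (W + X)) ≡ suc (V + W) + (s + X)
    swap = solve-∀

  -- Counting binomial coefficients by valuation

  countA : ℕ → ℕ → ℕ
  countA n k = sumBelow (λ x → δ (vC n x) k) (suc n)

  countCarry : ℕ → ℕ → ℕ
  countCarry m k = sumBelow (λ a → δ (suc (v m + vC (m ∸ 1) a)) k) m

  cardA≡countA : ∀ n k → cardA p n k ≡ countA n k
  cardA≡countA n k =
    length-filter-applyUpTo (λ x → (p ^ k ∣? (n C x)) ×-dec ¬? (p ^ suc k ∣? (n C x)))
                            (λ x → x) (suc n) (λ x → δ (vC n x) k) δ-spec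
    where
    δ-spec : ∀ x → x < suc n →
      (p ^ k ∥ (n C x) → δ (vC n x) k ≡ 1) × (¬ p ^ k ∥ (n C x) → δ (vC n x) k ≡ 0)
    δ-spec x x<sn = (λ p^k∥ → trans (cong (λ y → δ y k) (∥⇒v≡ {k = k} C>0′ p^k∥)) (δ-refl k))
                  , (λ ¬p^k∥ → δ-≢ _ k (¬p^k∥ ∘ v≡⇒∥ C>0′))
      where C>0′ = C>0 (≤-pred x<sn)

  -- Write x = p a + b with b < p: for b ≤ r no carry occurs and a ranges over 0..m,
  -- for b > r there is a carry and a ranges over 0..m-1.
  countA-p*+ : ∀ m r k → r < p →
    countA (p * m + r) k ≡ suc r * countA m k + (p ∸ suc r) * countCarry m k
  countA-p*+ m r k r<p = begin
    countA n k
      ≡⟨ cong (sumBelow f) (+-suc (p * m) r) ⟨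
    sumBelow f (p * m + suc r)
      ≡⟨ sumBelow-+ (p * m) (suc r) f ⟩
    sumBelow f (p * m) + sumBelow last (suc r)
      ≡⟨ cong (_+ sumBelow last (suc r)) (trans (sumBelow-* p m f) (sumBelow-comm m p (λ a b → f (p * a + b)))) ⟩
    sumBelow column p + sumBelow last (suc r)
      ≡⟨ cong (λ q → sumBelow column q + sumBelow last (suc r)) (m+[n∸m]≡n r<p) ⟨
    sumBelow column (suc r + q) + sumBelow last (suc r)
      ≡⟨ cong (_+ sumBelow last (suc r)) (sumBelow-+ (suc r) q column) ⟩
    sumBelow column (suc r) + sumBelow (column ∘ (suc r +_)) q + sumBelow last (suc r)
      ≡⟨ swap (sumBelow column (suc r)) _ _ ⟩
    (sumBelow column (suc r) + sumBelow last (suc r)) + sumBelow (column ∘ (suc r +_)) q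
      ≡⟨ cong (_+ sumBelow (column ∘ (suc r +_)) q) (sumBelow-distrib (suc r) column last) ⟨
    sumBelow (λ b → column b + last b) (suc r) + sumBelow (column ∘ (suc r +_)) q
      ≡⟨ cong₂ _+_ (sumBelow-cong (suc r) no-carry) (sumBelow-cong q carry) ⟩
    sumBelow (λ _ → countA m k) (suc r) + sumBelow (λ _ → countCarry m k) q
      ≡⟨ cong₂ _+_ (sumBelow-const (suc r) (countA m k)) (sumBelow-const q (countCarry m k)) ⟩
    suc r * countA m k + q * countCarry m k
      ∎
    where
    open ≡-Reasoning
    n = p * m + r
    q = p ∸ suc r
    f : ℕ → ℕ
    f x = δ (vC n x) k
    last column : ℕ → ℕ
    last b = f (p * m + b)
    column b = sumBelow (λ a → f (p * a + b)) m
    swap : ∀ a b c → a + b + c ≡ a + c + b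
    swap = solve-∀
    no-carry : ∀ b → b < suc r → column b + last b ≡ countA m k
    no-carry b b<sr = trans (sym (sumBelow-sucʳ m (λ a → f (p * a + b))))
      (sumBelow-cong (suc m) (λ a a<sm → cong (λ y → δ y k) (vC-no-carry (≤-pred a<sm) (≤-pred b<sr) r<p)))
    carry : ∀ d → d < q → column (suc r + d) ≡ countCarry m k
    carry d d<q = sumBelow-cong m (λ a a<m → cong (λ y → δ y k)
      (vC-carry a<m (s≤s (m≤m+n r d)) (subst (suc r + d <_) (m+[n∸m]≡n r<p) (+-monoʳ-< (suc r) d<q))))

  countA-p*+-zero : ∀ m r → r < p → countA (p * m + r) 0 ≡ suc r * countA m 0
  countA-p*+-zero m r r<p = begin
    countA (p * m + r) 0
      ≡⟨ countA-p*+ m r 0 r<p ⟩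
    suc r * countA m 0 + (p ∸ suc r) * countCarry m 0
      ≡⟨ cong (λ z → suc r * countA m 0 + (p ∸ suc r) * z) (trans (sumBelow-const m 0) (*-zeroʳ m)) ⟩
    suc r * countA m 0 + (p ∸ suc r) * 0
      ≡⟨ cong (suc r * countA m 0 +_) (*-zeroʳ (p ∸ suc r)) ⟩
    suc r * countA m 0 + 0
      ≡⟨ +-identityʳ _ ⟩
    suc r * countA m 0
      ∎
    where open ≡-Reasoning

  countA-p*+p∸1 : ∀ m k → countA (p * m + (p ∸ 1)) k ≡ p * countA m k
  countA-p*+p∸1 m k = begin
    countA (p * m + (p ∸ 1)) k
      ≡⟨ countA-p*+ m (p ∸ 1) k p∸1<p ⟩
    suc (p ∸ 1) * countA m k + (p ∸ suc (p ∸ 1)) * countCarry m k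
      ≡⟨ cong (λ q → q * countA m k + (p ∸ q) * countCarry m k) suc[p∸1]≡p ⟩
    p * countA m k + (p ∸ p) * countCarry m k
      ≡⟨ cong (λ q → p * countA m k + q * countCarry m k) (n∸n≡0 p) ⟩
    p * countA m k + 0
      ≡⟨ +-identityʳ _ ⟩
    p * countA m k
      ∎
    where open ≡-Reasoning

  suc[p∸2]≡p∸1 : suc (p ∸ 2) ≡ p ∸ 1
  suc[p∸2]≡p∸1 = sym (+-∸-assoc 1 p>1)

  p∸2<p : p ∸ 2 < p
  p∸2<p = subst (_≤ p) (sym suc[p∸2]≡p∸1) (<⇒≤ p∸1<p)

  -- The carries out of the digit p - 2 raise the valuation by exactly one, as p ∤ m + 1.
  countA-p*suc+p∸2 : ∀ m k → ¬ p ∣ suc m →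
    countA (p * suc m + (p ∸ 2)) (suc k) ≡ (p ∸ 1) * countA (suc m) (suc k) + countA m k
  countA-p*suc+p∸2 m k p∤ = begin
    countA (p * suc m + (p ∸ 2)) (suc k)
      ≡⟨ countA-p*+ (suc m) (p ∸ 2) (suc k) p∸2<p ⟩
    suc (p ∸ 2) * countA (suc m) (suc k) + (p ∸ suc (p ∸ 2)) * countCarry (suc m) (suc k)
      ≡⟨ cong (λ q → q * countA (suc m) (suc k) + (p ∸ q) * countCarry (suc m) (suc k)) suc[p∸2]≡p∸1 ⟩
    (p ∸ 1) * countA (suc m) (suc k) + (p ∸ (p ∸ 1)) * countCarry (suc m) (suc k)
      ≡⟨ cong (λ q → (p ∸ 1) * countA (suc m) (suc k) + q * countCarry (suc m) (suc k)) (m∸[m∸n]≡n (<⇒≤ p>1)) ⟩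
    (p ∸ 1) * countA (suc m) (suc k) + (countCarry (suc m) (suc k) + 0)
      ≡⟨ cong ((p ∸ 1) * countA (suc m) (suc k) +_) (trans (+-identityʳ _) carries) ⟩
    (p ∸ 1) * countA (suc m) (suc k) + countA m k
      ∎
    where
    open ≡-Reasoning
    carries : countCarry (suc m) (suc k) ≡ countA m k
    carries = sumBelow-cong (suc m) (λ a _ → cong (λ z → δ (z + vC m a) k) (v-p∤ p∤))

  countA-<p : ∀ n k → n < p → countA n k ≡ suc n * δ 0 k
  countA-<p n k n<p = begin
    countA n k
      ≡⟨ cong (λ z → countA (z + n) k) (*-zeroʳ p) ⟨
    countA (p * 0 + n) k
      ≡⟨ countA-p*+ 0 n k n<p ⟩
    suc n * (δ (v 1) k + 0) + (p ∸ suc n) * 0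
      ≡⟨ cong (λ z → suc n * (δ z k + 0) + (p ∸ suc n) * 0) (v-p∤ p∤1) ⟩
    suc n * (δ 0 k + 0) + (p ∸ suc n) * 0
      ≡⟨ cong₂ _+_ (cong (suc n *_) (+-identityʳ _)) (*-zeroʳ (p ∸ suc n)) ⟩
    suc n * δ 0 k + 0
      ≡⟨ +-identityʳ _ ⟩
    suc n * δ 0 k
      ∎
    where open ≡-Reasoning

  countA>0 : ∀ n → 0 < countA n 0
  countA>0 n = subst (λ z → 0 < δ z 0 + sumBelow (λ x → δ (vC n (suc x)) 0) n) (sym (v-p∤ p∤1)) z<s

  countA≤ : ∀ n k → countA n k ≤ suc n
  countA≤ n k = sumBelow-≤ (suc n) (λ x → δ (vC n x) k) (λ x → δ-≤1 (vC n x) k)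

  suc≡p*⇒ : ∀ {n X} → suc n ≡ p * X → ∃[ m ] X ≡ suc m × n ≡ p * m + (p ∸ 1)
  suc≡p*⇒ {X = zero}  eq = contradiction (trans eq (*-zeroʳ p)) λ ()
  suc≡p*⇒ {X = suc m} eq = m , refl , suc-injective (trans eq (p*suc≡suc[p*+p∸1] m))

  -- Trailing digits p - 1 of n scale every count by p.
  countA-p^* : ∀ j {n q} → suc n ≡ p ^ j * suc q → ∀ k → countA n k ≡ p ^ j * countA q k
  countA-p^* zero    {n} {q} eq k =
    trans (cong (λ z → countA z k) (suc-injective (trans eq (*-identityˡ (suc q))))) (sym (*-identityˡ _))
  countA-p^* (suc j) {n} {q} eq k with m , e , refl ← suc≡p*⇒ (trans eq (*-assoc p (p ^ j) (suc q))) = begin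
    countA (p * m + (p ∸ 1)) k   ≡⟨ countA-p*+p∸1 m k ⟩
    p * countA m k               ≡⟨ cong (p *_) (countA-p^* j (sym e) k) ⟩
    p * (p ^ j * countA q k)     ≡⟨ *-assoc p (p ^ j) _ ⟨
    p ^ suc j * countA q k       ∎
    where open ≡-Reasoning

  countA-leading : ∀ L {n c} → c < p → suc n ≡ c * p ^ L → ∀ k → countA n k ≡ suc n * δ 0 k
  countA-leading L {n} {zero}  c<p eq k = contradiction eq λ ()
  countA-leading L {n} {suc q} c<p eq k = begin
    countA n k                  ≡⟨ countA-p^* L (trans eq (*-comm (suc q) (p ^ L))) k ⟩
    p ^ L * countA q k          ≡⟨ cong (p ^ L *_) (countA-<p q k (<-trans (n<1+n q) c<p)) ⟩
    p ^ L * (suc q * δ 0 k)     ≡⟨ *-assoc (p ^ L) (suc q) (δ 0 k) ⟨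
    p ^ L * suc q * δ 0 k       ≡⟨ cong (_* δ 0 k) (trans (*-comm (p ^ L) (suc q)) (sym eq)) ⟩
    suc n * δ 0 k               ∎
    where open ≡-Reasoning

  -- countA n k for n + 1 = p ^ (M + 1) - 1, whose base-p digits are M + 1 copies of p - 1.
  repdigitCount : ℕ → ℕ → ℕ
  repdigitCount M       zero    = (p ∸ 1) * p ^ M
  repdigitCount zero    (suc k) = 0
  repdigitCount (suc M) (suc k) = repdigitCount M k

  countA-repdigit : ∀ M {n} → suc (suc n) ≡ p ^ suc M → ∀ k → countA n k ≡ repdigitCount M k
  countA-repdigit zero {n} eq k = trans (countA-<p n k n<p) (lemma k)
    where
    sn≡p∸1 : suc n ≡ p ∸ 1
    sn≡p∸1 = cong (_∸ 1) (trans eq (*-identityʳ p))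
    n<p : n < p
    n<p = <⇒≤ (subst (_< p) (sym sn≡p∸1) p∸1<p)
    lemma : ∀ k → suc n * δ 0 k ≡ repdigitCount 0 k
    lemma zero    = cong (_* 1) sn≡p∸1
    lemma (suc k) = *-zeroʳ (suc n)
  countA-repdigit (suc M) {n} eq k
    with m , e , n+1≡ ← suc≡p*⇒ eq with m
  ... | zero    = contradiction (subst (p ≤_) e (m≤m*n p (p ^ M) {{m^n≢0 p M}})) (<⇒≱ p>1)
  ... | suc m′ = go k
    where
    n≡ : n ≡ p * suc m′ + (p ∸ 2)
    n≡ = suc-injective (trans n+1≡ (trans (cong (p * suc m′ +_) (sym suc[p∸2]≡p∸1)) (+-suc _ _)))
    p∤ : ¬ p ∣ suc m′
    p∤ p∣ = p∤1 (∣m+n∣m⇒∣n (subst (p ∣_) (trans e (+-comm 1 (suc m′))) (m∣m*n (p ^ M))) p∣)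
    countA-suc-m′ : ∀ k → countA (suc m′) k ≡ p ^ suc M * δ 0 k
    countA-suc-m′ k = trans (countA-p^* (suc M) (trans (sym e) (sym (*-identityʳ _))) k)
                            (cong (p ^ suc M *_) (trans (countA-<p 0 k (<-trans z<s p>1)) (+-identityʳ _)))
    go : ∀ k → countA n k ≡ repdigitCount (suc M) k
    go zero = begin
      countA n 0                                    ≡⟨ cong (λ z → countA z 0) n≡ ⟩
      countA (p * suc m′ + (p ∸ 2)) 0               ≡⟨ countA-p*+-zero (suc m′) (p ∸ 2) p∸2<p ⟩
      suc (p ∸ 2) * countA (suc m′) 0               ≡⟨ cong₂ _*_ suc[p∸2]≡p∸1 (countA-suc-m′ 0) ⟩
      (p ∸ 1) * (p ^ suc M * 1)                     ≡⟨ cong ((p ∸ 1) *_) (*-identityʳ _) ⟩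
      (p ∸ 1) * p ^ suc M                           ∎
      where open ≡-Reasoning
    go (suc k) = begin
      countA n (suc k)
        ≡⟨ cong (λ z → countA z (suc k)) n≡ ⟩
      countA (p * suc m′ + (p ∸ 2)) (suc k)
        ≡⟨ countA-p*suc+p∸2 m′ k p∤ ⟩
      (p ∸ 1) * countA (suc m′) (suc k) + countA m′ k
        ≡⟨ cong₂ _+_ (cong ((p ∸ 1) *_) (countA-suc-m′ (suc k))) (countA-repdigit M (sym e) k) ⟩
      (p ∸ 1) * (p ^ suc M * 0) + repdigitCount M k
        ≡⟨ cong (λ z → (p ∸ 1) * z + repdigitCount M k) (*-zeroʳ (p ^ suc M)) ⟩
      (p ∸ 1) * 0 + repdigitCount M k
        ≡⟨ cong (_+ repdigitCount M k) (*-zeroʳ (p ∸ 1)) ⟩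
      repdigitCount M k
        ∎
      where open ≡-Reasoning

  +p^≡*p^⇒ : ∀ {N j} P → 0 < N → N + p ^ j ≡ P * p ^ j → ∃[ q ] P ≡ suc (suc q) × N ≡ p ^ j * suc q
  +p^≡*p^⇒ {N} {j} zero N>0 eq = contradiction (m+n≡0⇒m≡0 N eq) (>⇒≢ N>0)
  +p^≡*p^⇒ {N} {j} (suc zero) N>0 eq =
    contradiction (+-cancelʳ-≡ (p ^ j) N 0 (trans eq (+-identityʳ (p ^ j)))) (>⇒≢ N>0)
  +p^≡*p^⇒ {N} {j} (suc (suc q)) N>0 eq =
    q , refl , +-cancelʳ-≡ (p ^ j) N (p ^ j * suc q)
      (trans eq (trans (+-comm (p ^ j) _) (cong (_+ p ^ j) (*-comm (suc q) (p ^ j)))))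

  countA-repdigit*p^ : ∀ M j {n} → suc n + p ^ j ≡ p ^ suc M * p ^ j → ∀ k → countA n k ≡ p ^ j * repdigitCount M k
  countA-repdigit*p^ M j {n} eq k with q , P≡ , n+1≡ ← +p^≡*p^⇒ {j = j} (p ^ suc M) z<s eq =
    trans (countA-p^* j {n} {q} n+1≡ k) (cong (p ^ j *_) (countA-repdigit M {q} (sym P≡) k))

  -- The shapes of n + 1 for the Zumkeller numbers n in base p.
  data SuccForm (N : ℕ) : Set where
    leading  : ∀ c L → 0 < c → c < p → N ≡ c * p ^ L → SuccForm N
    repdigit : ∀ M j → 0 < M → N + p ^ j ≡ p ^ suc M * p ^ j → SuccForm N

  SuccForm-p* : ∀ {N} → SuccForm N → SuccForm (p * N)
  SuccForm-p* {N} (leading c L c>0 c<p N≡) = leading c (suc L) c>0 c<p (begin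
    p * N           ≡⟨ cong (p *_) N≡ ⟩
    p * (c * p ^ L) ≡⟨ *-left-comm p c (p ^ L) ⟩
    c * p ^ suc L   ∎)
    where open ≡-Reasoning
  SuccForm-p* {N} (repdigit M j M>0 N+p^j≡) = repdigit M (suc j) M>0 (begin
    p * N + p * p ^ j        ≡⟨ *-distribˡ-+ p N (p ^ j) ⟨
    p * (N + p ^ j)          ≡⟨ cong (p *_) N+p^j≡ ⟩
    p * (p ^ suc M * p ^ j)  ≡⟨ *-left-comm p (p ^ suc M) (p ^ j) ⟩
    p ^ suc M * p ^ suc j    ∎)
    where open ≡-Reasoning

  -- p ∤ r + 1 forces p ^ L ∣ countA m 0, while countA m 0 ≤ m + 1 ≤ p ^ L.
  countA-rigid : ∀ L {m r d} → 0 < d → suc r < p → m < p ^ L → suc r * countA m 0 ≡ d * p ^ L →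
    suc m ≡ p ^ L × suc r ≡ d
  countA-rigid L {m} {r} {d} d>0 r+1<p m<p^L eq = sm≡P , *-cancelʳ-≡ (suc r) d P {{m^n≢0 p L}} (begin
    suc r * P     ≡⟨ cong (suc r *_) X≡P ⟨
    suc r * X     ≡⟨ eq ⟩
    d * P         ∎)
    where
    open ≡-Reasoning
    P = p ^ L
    X = countA m 0
    L≤vX : L ≤ v X
    L≤vX = ≤-trans (m≤n+m L (v d)) (≤-reflexive (begin
      v d + L               ≡⟨ cong (v d +_) (v-p^ L) ⟨
      v d + v P             ≡⟨ v-* d>0 (m^n>0 p L) ⟨
      v (d * P)             ≡⟨ cong v eq ⟨
      v (suc r * X)         ≡⟨ v-* z<s (countA>0 m) ⟩
      v (suc r) + v X       ≡⟨ cong (_+ v X) (v-p∤ (λ p∣ → <⇒≱ r+1<p (∣⇒≤ p∣))) ⟩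
      v X                   ∎))
    P≤X : P ≤ X
    P≤X = ∣⇒≤ {{>-nonZero (countA>0 m)}} (≤v⇒∣ (countA>0 m) L≤vX)
    sm≡P : suc m ≡ P
    sm≡P = ≤-antisym m<p^L (≤-trans P≤X (countA≤ m 0))
    X≡P : X ≡ P
    X≡P = ≤-antisym (subst (X ≤_) sm≡P (countA≤ m 0)) P≤X

  leading-digit-p∸1 : ∀ {m d P} → d < p → p ≤ P → suc m ≡ P → p * m + d < suc d * P → suc d ≡ p
  leading-digit-p∸1 {m} {d} {P} d<p p≤P sm≡P bound = ≤-antisym d<p (≮⇒≥ λ d+1<p → <-irrefl refl (begin-strict
    p * m + d + p          <⟨ +-monoˡ-< p bound ⟩
    suc d * P + p          ≤⟨ +-monoʳ-≤ (suc d * P) p≤P ⟩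
    suc d * P + P          ≡⟨ +-comm (suc d * P) P ⟩
    suc (suc d) * P        ≤⟨ *-monoˡ-≤ P d+1<p ⟩
    p * P                  ≡⟨ cong (p *_) sm≡P ⟨
    p * suc m              ≡⟨ trans (*-suc p m) (+-comm p (p * m)) ⟩
    p * m + p              ≤⟨ +-monoˡ-≤ p (m≤m+n (p * m) d) ⟩
    p * m + d + p          ∎))
    where open ≤-Reasoning

  divMod-p : ∀ n → ∃[ m ] ∃[ r ] r < p × n ≡ p * m + r
  divMod-p n = n / p , n % p , m%n<n n p ,
    trans (m≡m%n+[m/n]*n n p) (trans (+-comm (n % p) _) (cong (_+ n % p) (*-comm (n / p) p)))

  countA⇒repdigit : ∀ L {m r d} → 0 < d → d < p → suc r < p → suc (p * m + r) < suc d * p ^ suc L →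
    countA (p * m + r) 0 ≡ d * p ^ suc L → suc (p * m + r) + 1 ≡ p ^ suc (suc L) * 1
  countA⇒repdigit L {m} {r} {d} d>0 d<p r+1<p upper count = begin-equality
    suc (p * m + r) + 1   ≡⟨ +-comm (suc (p * m + r)) 1 ⟩
    suc (suc (p * m + r)) ≡⟨ cong suc (+-suc (p * m) r) ⟨
    suc (p * m + suc r)   ≡⟨ cong (λ z → suc (p * m + z)) r+1≡d ⟩
    suc (p * m + d)       ≡⟨ +-suc (p * m) d ⟨
    p * m + suc d         ≡⟨ cong (p * m +_) d+1≡p ⟩
    p * m + p             ≡⟨ trans (+-comm (p * m) p) (sym (*-suc p m)) ⟩
    p * suc m             ≡⟨ cong (p *_) m+1≡P ⟩
    p * P                 ≡⟨ *-identityʳ (p * P) ⟨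
    p * P * 1             ∎
    where
    open ≤-Reasoning
    P = p ^ suc L
    m<P : m < P
    m<P = *-cancelˡ-< p m P (begin-strict
      p * m                 ≤⟨ m≤m+n (p * m) r ⟩
      p * m + r             <⟨ n<1+n (p * m + r) ⟩
      suc (p * m + r)       <⟨ upper ⟩
      suc d * P             ≤⟨ *-monoˡ-≤ P d<p ⟩
      p * P                 ∎)
    rigid = countA-rigid (suc L) d>0 r+1<p m<P (begin-equality
      suc r * countA m 0    ≡⟨ countA-p*+-zero m r (<-trans (n<1+n r) r+1<p) ⟨
      countA (p * m + r) 0  ≡⟨ count ⟩
      d * P                 ∎)
    m+1≡P = proj₁ rigid
    r+1≡d = proj₂ rigid
    d+1≡p : suc d ≡ p
    d+1≡p = leading-digit-p∸1 d<p (m≤m*n p (p ^ L) {{m^n≢0 p L}}) m+1≡P (begin-strict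
      p * m + d             ≡⟨ cong (p * m +_) r+1≡d ⟨
      p * m + suc r         ≡⟨ +-suc (p * m) r ⟩
      suc (p * m + r)       <⟨ upper ⟩
      suc d * P             ∎)

  countA⇒SuccForm : ∀ L {n d} → 0 < d → d < p → d * p ^ L ≤ suc n → suc n < suc d * p ^ L →
    countA n 0 ≡ d * p ^ L → SuccForm (suc n)
  countA⇒SuccForm zero d>0 d<p lower upper _ = leading _ 0 d>0 d<p (≤-antisym (≤-pred upper) lower)
  countA⇒SuccForm (suc L) {n} {d} d>0 d<p lower upper count
    with m , r , r<p , refl ← divMod-p n
    with r ≟ p ∸ 1
  ... | no r≢p∸1 =
    repdigit (suc L) 0 z<s (countA⇒repdigit L d>0 d<p (≤∧≢⇒< r<p (r≢p∸1 ∘ cong (_∸ 1))) upper count)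
  ... | yes refl =
    subst SuccForm (sym n+1≡) (SuccForm-p* (countA⇒SuccForm L d>0 d<p lower′ upper′ count′))
    where
    n+1≡ : suc (p * m + (p ∸ 1)) ≡ p * suc m
    n+1≡ = sym (p*suc≡suc[p*+p∸1] m)
    lower′ : d * p ^ L ≤ suc m
    lower′ = *-cancelˡ-≤ p (subst₂ _≤_ (*-left-comm d p (p ^ L)) n+1≡ lower)
    upper′ : suc m < suc d * p ^ L
    upper′ = *-cancelˡ-< p _ _ (subst₂ _<_ n+1≡ (*-left-comm (suc d) p (p ^ L)) upper)
    count′ : countA m 0 ≡ d * p ^ L
    count′ = *-cancelˡ-≡ _ _ p (begin
      p * countA m 0              ≡⟨ countA-p*+p∸1 m 0 ⟨
      countA (p * m + (p ∸ 1)) 0  ≡⟨ count ⟩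
      d * p ^ suc L               ≡⟨ *-left-comm d p (p ^ L) ⟩
      p * (d * p ^ L)             ∎)
      where open ≡-Reasoning

  -- Base-p digit lists

  foldl-evalDigits : ∀ acc ds → foldl (λ a d → a * p + d) acc ds ≡ acc * p ^ length ds + evalDigits p ds
  foldl-evalDigits acc []       = sym (trans (+-identityʳ _) (*-identityʳ acc))
  foldl-evalDigits acc (d ∷ ds) = begin
    foldl _ (acc * p + d) ds
      ≡⟨ foldl-evalDigits (acc * p + d) ds ⟩
    (acc * p + d) * p ^ length ds + evalDigits p ds
      ≡⟨ regroup acc p d (p ^ length ds) _ ⟩
    acc * (p * p ^ length ds) + (d * p ^ length ds + evalDigits p ds)
      ≡⟨ cong (acc * p ^ suc (length ds) +_) (foldl-evalDigits d ds) ⟨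
    acc * p ^ suc (length ds) + evalDigits p (d ∷ ds)
      ∎
    where
    open ≡-Reasoning
    regroup : ∀ a q d P E → (a * q + d) * P + E ≡ a * (q * P) + (d * P + E)
    regroup = solve-∀

  evalDigits-∷ : ∀ d ds → evalDigits p (d ∷ ds) ≡ d * p ^ length ds + evalDigits p ds
  evalDigits-∷ = foldl-evalDigits

  evalDigits<p^length : ∀ {ds} → All (_< p) ds → evalDigits p ds < p ^ length ds
  evalDigits<p^length {[]}     []          = z<s
  evalDigits<p^length {d ∷ ds} (d<p ∷ ds<p) = begin-strict
    evalDigits p (d ∷ ds)        ≡⟨ evalDigits-∷ d ds ⟩
    d * P + evalDigits p ds      <⟨ +-monoʳ-< (d * P) (evalDigits<p^length ds<p) ⟩
    d * P + P                    ≡⟨ +-comm (d * P) P ⟩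
    suc d * P                    ≤⟨ *-monoˡ-≤ P d<p ⟩
    p * P                        ∎
    where
    open ≤-Reasoning
    P = p ^ length ds

  evalDigits-zeros : ∀ L → evalDigits p (replicate L 0) ≡ 0
  evalDigits-zeros zero    = refl
  evalDigits-zeros (suc L) = evalDigits-zeros L

  max∷-evalDigits : ∀ ds {E} → evalDigits p ds + E ≡ p ^ length ds →
    evalDigits p (p ∸ 1 ∷ ds) + E ≡ p ^ suc (length ds)
  max∷-evalDigits ds {E} eq = begin
    evalDigits p (p ∸ 1 ∷ ds) + E             ≡⟨ cong (_+ E) (evalDigits-∷ (p ∸ 1) ds) ⟩
    (p ∸ 1) * P + evalDigits p ds + E         ≡⟨ +-assoc ((p ∸ 1) * P) _ E ⟩
    (p ∸ 1) * P + (evalDigits p ds + E)       ≡⟨ cong ((p ∸ 1) * P +_) eq ⟩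
    (p ∸ 1) * P + P                           ≡⟨ +-comm ((p ∸ 1) * P) P ⟩
    suc (p ∸ 1) * P                           ≡⟨ cong (_* P) suc[p∸1]≡p ⟩
    p * P                                     ∎
    where
    open ≡-Reasoning
    P = p ^ length ds

  evalDigits-max : ∀ ds → (∀ k → lookup ds k ≡ p ∸ 1) → evalDigits p ds + 1 ≡ p ^ length ds
  evalDigits-max []       _   = refl
  evalDigits-max (d ∷ ds) max =
    subst (λ z → evalDigits p (z ∷ ds) + 1 ≡ _) (sym (max zero)) (max∷-evalDigits ds (evalDigits-max ds (max ∘ suc)))

  evalDigits-dip : ∀ ds i → (∀ k → k ≢ i → lookup ds k ≡ p ∸ 1) → lookup ds i ≡ p ∸ 2 →
    evalDigits p ds + suc (p ^ (length ds ∸ suc (toℕ i))) ≡ p ^ length ds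
  evalDigits-dip (d ∷ ds) zero others d≡p∸2 = begin
    evalDigits p (d ∷ ds) + suc P
      ≡⟨ cong (_+ suc P) (evalDigits-∷ d ds) ⟩
    d * P + evalDigits p ds + suc P
      ≡⟨ regroup (d * P) (evalDigits p ds) P ⟩
    d * P + (evalDigits p ds + 1) + P
      ≡⟨ cong₂ (λ a b → a * P + b + P) d≡p∸2 (evalDigits-max ds (λ k → others (suc k) λ ())) ⟩
    (p ∸ 2) * P + P + P
      ≡⟨ regroup′ (p ∸ 2) P ⟩
    suc (suc (p ∸ 2)) * P
      ≡⟨ cong (_* P) (trans (cong suc suc[p∸2]≡p∸1) suc[p∸1]≡p) ⟩
    p * P
      ∎
    where
    open ≡-Reasoning
    P = p ^ length ds
    regroup : ∀ a b c → a + b + suc c ≡ a + (b + 1) + c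
    regroup = solve-∀
    regroup′ : ∀ a P → a * P + P + P ≡ suc (suc a) * P
    regroup′ = solve-∀
  evalDigits-dip (d ∷ ds) (suc i) others d′≡p∸2 =
    subst (λ z → evalDigits p (z ∷ ds) + _ ≡ _) (sym (others zero λ ()))
      (max∷-evalDigits ds (evalDigits-dip ds i (λ k k≢i → others (suc k) (k≢i ∘ fsuc-injective)) d′≡p∸2))

  DigitProfile : List ℕ → (ℕ → ℕ) → Set
  DigitProfile ds f = (k : Fin (length ds)) → f (toℕ k) ≡ lookup ds k * p ^ (length ds ∸ suc (toℕ k))

  DigitProfile-∷ : ∀ {d ds} f → f 0 ≡ d * p ^ length ds → DigitProfile ds (f ∘ suc) → DigitProfile (d ∷ ds) f
  DigitProfile-∷ f f0≡ rest zero    = f0≡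
  DigitProfile-∷ f f0≡ rest (suc k) = rest k

  DigitProfile-zeros : ∀ L {f} → (∀ k → f k ≡ 0) → DigitProfile (replicate L 0) f
  DigitProfile-zeros (suc L) f≡0 zero    = f≡0 0
  DigitProfile-zeros (suc L) f≡0 (suc k) = DigitProfile-zeros L (f≡0 ∘ suc) k

  maxThenZeros : ℕ → ℕ → List ℕ
  maxThenZeros zero    j = p ∸ 1 ∷ replicate j 0
  maxThenZeros (suc M) j = p ∸ 1 ∷ maxThenZeros M j

  length-maxThenZeros : ∀ M j → length (maxThenZeros M j) ≡ suc M + j
  length-maxThenZeros zero    j = cong suc (length-replicate j)
  length-maxThenZeros (suc M) j = cong suc (length-maxThenZeros M j)

  maxThenZeros<p : ∀ M j → All (_< p) (maxThenZeros M j)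
  maxThenZeros<p zero    j = p∸1<p ∷ replicate⁺ j (<-trans z<s p>1)
  maxThenZeros<p (suc M) j = p∸1<p ∷ maxThenZeros<p M j

  evalDigits-maxThenZeros : ∀ M j → evalDigits p (maxThenZeros M j) + p ^ j ≡ p ^ length (maxThenZeros M j)
  evalDigits-maxThenZeros zero    j = max∷-evalDigits (replicate j 0)
    (cong₂ (λ e l → e + p ^ l) (evalDigits-zeros j) (sym (length-replicate j)))
  evalDigits-maxThenZeros (suc M) j = max∷-evalDigits (maxThenZeros M j) (evalDigits-maxThenZeros M j)

  DigitProfile-maxThenZeros : ∀ M j → DigitProfile (maxThenZeros M j) (λ k → p ^ j * repdigitCount M k)
  DigitProfile-maxThenZeros zero j = DigitProfile-∷ (λ k → p ^ j * repdigitCount 0 k)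
    (trans (*-comm (p ^ j) _) (cong₂ (λ a l → a * p ^ l) (*-identityʳ (p ∸ 1)) (sym (length-replicate j))))
    (DigitProfile-zeros j (λ k → *-zeroʳ (p ^ j)))
  DigitProfile-maxThenZeros (suc M) j = DigitProfile-∷ (λ k → p ^ j * repdigitCount (suc M) k)
    (trans (*-left-comm (p ^ j) (p ∸ 1) (p ^ suc M)) (cong ((p ∸ 1) *_) (begin
      p ^ j * p ^ suc M              ≡⟨ *-comm (p ^ j) (p ^ suc M) ⟩
      p ^ suc M * p ^ j              ≡⟨ ^-distribˡ-+-* p (suc M) j ⟨
      p ^ (suc M + j)                ≡⟨ cong (p ^_) (length-maxThenZeros M j) ⟨
      p ^ length (maxThenZeros M j)  ∎)))
    (DigitProfile-maxThenZeros M j)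
    where open ≡-Reasoning

  predictor⇒SuccForm : ∀ {n} → BinomialPredictor p n → SuccForm (suc n)
  predictor⇒SuccForm {n} (d ∷ ds , (d<p ∷ ds<p , (_ , d>0) , eval≡) , profile) =
    countA⇒SuccForm (length ds) d>0 d<p lower upper (trans (sym (cardA≡countA n 0)) (profile zero))
    where
    P = p ^ length ds
    n+1≡ : suc n ≡ d * P + evalDigits p ds
    n+1≡ = trans (sym eval≡) (evalDigits-∷ d ds)
    lower : d * P ≤ suc n
    lower = subst (d * P ≤_) (sym n+1≡) (m≤m+n (d * P) _)
    upper : suc n < suc d * P
    upper = subst₂ _<_ (sym n+1≡) (+-comm (d * P) P) (+-monoʳ-< (d * P) (evalDigits<p^length ds<p))

  SuccForm⇒predictor : ∀ {n} → SuccForm (suc n) → BinomialPredictor p n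
  SuccForm⇒predictor {n} (leading c L c>0 c<p n+1≡) =
    c ∷ replicate L 0 , (c<p ∷ replicate⁺ L (<-trans z<s p>1) , (z<s , c>0) , eval≡) ,
    DigitProfile-∷ (cardA p n)
      (trans (cardA≡countA n 0) (trans (countA-leading L c<p n+1≡ 0)
        (trans (*-identityʳ (suc n)) (trans n+1≡ (cong (λ l → c * p ^ l) (sym (length-replicate L)))))))
      (DigitProfile-zeros L λ k →
        trans (cardA≡countA n (suc k)) (trans (countA-leading L c<p n+1≡ (suc k)) (*-zeroʳ (suc n))))
    where
    eval≡ : evalDigits p (c ∷ replicate L 0) ≡ suc n
    eval≡ = begin
      evalDigits p (c ∷ replicate L 0)
        ≡⟨ evalDigits-∷ c (replicate L 0) ⟩
      c * p ^ length (replicate L 0) + evalDigits p (replicate L 0)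
        ≡⟨ cong₂ (λ l e → c * p ^ l + e) (length-replicate L) (evalDigits-zeros L) ⟩
      c * p ^ L + 0
        ≡⟨ +-identityʳ _ ⟩
      c * p ^ L
        ≡⟨ n+1≡ ⟨
      suc n
        ∎
      where open ≡-Reasoning
  SuccForm⇒predictor {n} (repdigit zero j () _)
  SuccForm⇒predictor {n} (repdigit M@(suc _) j _ n+1+p^j≡) =
    maxThenZeros M j , (maxThenZeros<p M j , (z<s , p∸1≥1) , eval≡) ,
    λ k → trans (cardA≡countA n (toℕ k))
                (trans (countA-repdigit*p^ M j n+1+p^j≡ (toℕ k)) (DigitProfile-maxThenZeros M j k))
    where
    eval≡ : evalDigits p (maxThenZeros M j) ≡ suc n
    eval≡ = +-cancelʳ-≡ (p ^ j) _ _ (begin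
      evalDigits p (maxThenZeros M j) + p ^ j     ≡⟨ evalDigits-maxThenZeros M j ⟩
      p ^ length (maxThenZeros M j)               ≡⟨ cong (p ^_) (length-maxThenZeros M j) ⟩
      p ^ (suc M + j)                             ≡⟨ ^-distribˡ-+-* p (suc M) j ⟩
      p ^ suc M * p ^ j                           ≡⟨ n+1+p^j≡ ⟨
      suc n + p ^ j                               ∎)
      where open ≡-Reasoning

  Zumkeller⇒SuccForm : ∀ {n} → Zumkeller p n → SuccForm (suc n)
  Zumkeller⇒SuccForm (inj₁ refl) = leading 1 0 z<s p>1 refl
  Zumkeller⇒SuccForm {n} (inj₂ (ds , (_ , _ , eval≡) , inj₁ max)) =
    leading 1 (length ds) z<s p>1 (begin
      suc n                    ≡⟨ +-comm 1 n ⟩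
      n + 1                    ≡⟨ cong (_+ 1) eval≡ ⟨
      evalDigits p ds + 1      ≡⟨ evalDigits-max ds max ⟩
      p ^ length ds            ≡⟨ *-identityˡ _ ⟨
      1 * p ^ length ds        ∎)
    where open ≡-Reasoning
  Zumkeller⇒SuccForm {n} (inj₂ (d ∷ ds , (_ , _ , eval≡) , inj₂ (zero , others , inj₁ (_ , _ , d≤p∸2)))) =
    leading (suc d) (length ds) z<s d+1<p (begin
      suc n                               ≡⟨ cong suc eval≡ ⟨
      suc (evalDigits p (d ∷ ds))         ≡⟨ cong suc (evalDigits-∷ d ds) ⟩
      suc (d * P + evalDigits p ds)       ≡⟨ regroup (d * P) (evalDigits p ds) ⟩
      d * P + (evalDigits p ds + 1)       ≡⟨ cong (d * P +_) (evalDigits-max ds (λ k → others (suc k) λ ())) ⟩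
      d * P + P                           ≡⟨ +-comm (d * P) P ⟩
      suc d * P                           ∎)
    where
    open ≡-Reasoning
    P = p ^ length ds
    regroup : ∀ a b → suc (a + b) ≡ a + (b + 1)
    regroup = solve-∀
    d+1<p : suc d < p
    d+1<p = subst (suc (suc d) ≤_) (trans (cong suc suc[p∸2]≡p∸1) suc[p∸1]≡p) (s≤s (s≤s d≤p∸2))
  Zumkeller⇒SuccForm (inj₂ (_ ∷ _ , _ , inj₂ (suc _ , _ , inj₁ (() , _ , _))))
  Zumkeller⇒SuccForm {n} (inj₂ (ds , (_ , _ , eval≡) , inj₂ (i , others , inj₂ (i≥1 , dip)))) =
    repdigit (toℕ i) j i≥1 (begin
      suc n + p ^ j                  ≡⟨ +-suc n (p ^ j) ⟨
      n + suc (p ^ j)                ≡⟨ cong (_+ suc (p ^ j)) eval≡ ⟨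
      evalDigits p ds + suc (p ^ j)  ≡⟨ evalDigits-dip ds i others dip ⟩
      p ^ length ds                  ≡⟨ cong (p ^_) (m+[n∸m]≡n (toℕ<n i)) ⟨
      p ^ (suc (toℕ i) + j)          ≡⟨ ^-distribˡ-+-* p (suc (toℕ i)) j ⟩
      p ^ suc (toℕ i) * p ^ j        ∎)
    where
    open ≡-Reasoning
    j = length ds ∸ suc (toℕ i)

  maxWithDip : ℕ → ℕ → List ℕ
  maxWithDip zero    j = p ∸ 2 ∷ replicate j (p ∸ 1)
  maxWithDip (suc M) j = p ∸ 1 ∷ maxWithDip M j

  dipIndex : ∀ M j → Fin (length (maxWithDip M j))
  dipIndex zero    j = zero
  dipIndex (suc M) j = suc (dipIndex M j)

  toℕ-dipIndex : ∀ M j → toℕ (dipIndex M j) ≡ M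
  toℕ-dipIndex zero    j = refl
  toℕ-dipIndex (suc M) j = cong suc (toℕ-dipIndex M j)

  lookup-dipIndex : ∀ M j → lookup (maxWithDip M j) (dipIndex M j) ≡ p ∸ 2
  lookup-dipIndex zero    j = refl
  lookup-dipIndex (suc M) j = lookup-dipIndex M j

  lookup-maxWithDip : ∀ M j k → k ≢ dipIndex M j → lookup (maxWithDip M j) k ≡ p ∸ 1
  lookup-maxWithDip zero    j zero    k≢i = contradiction refl k≢i
  lookup-maxWithDip zero    j (suc k) k≢i = lookup-replicate′ j (p ∸ 1) k
  lookup-maxWithDip (suc M) j zero    k≢i = refl
  lookup-maxWithDip (suc M) j (suc k) k≢i = lookup-maxWithDip M j k (k≢i ∘ cong suc)

  maxWithDip<p : ∀ M j → All (_< p) (maxWithDip M j)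
  maxWithDip<p zero    j = p∸2<p ∷ replicate⁺ j p∸1<p
  maxWithDip<p (suc M) j = p∸1<p ∷ maxWithDip<p M j

  length-maxWithDip : ∀ M j → length (maxWithDip M j) ≡ suc M + j
  length-maxWithDip zero    j = cong suc (length-replicate j)
  length-maxWithDip (suc M) j = cong suc (length-maxWithDip M j)

  SuccForm⇒Zumkeller : ∀ {n} → SuccForm (suc n) → Zumkeller p n
  SuccForm⇒Zumkeller (leading zero _ () _ _)
  SuccForm⇒Zumkeller (leading 1 zero _ _ n+1≡) = inj₁ (suc-injective n+1≡)
  SuccForm⇒Zumkeller {n} (leading 1 (suc L) _ _ n+1≡) =
    inj₂ (ds , (replicate⁺ (suc L) p∸1<p , (z<s , p∸1≥1) , eval≡) , inj₁ (lookup-replicate′ (suc L) (p ∸ 1)))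
    where
    open ≡-Reasoning
    ds = replicate (suc L) (p ∸ 1)
    eval≡ : evalDigits p ds ≡ n
    eval≡ = +-cancelʳ-≡ 1 _ _ (begin
      evalDigits p ds + 1      ≡⟨ evalDigits-max ds (lookup-replicate′ (suc L) (p ∸ 1)) ⟩
      p ^ length ds            ≡⟨ cong (p ^_) (length-replicate (suc L)) ⟩
      p ^ suc L                ≡⟨ trans n+1≡ (*-identityˡ _) ⟨
      suc n                    ≡⟨ +-comm 1 n ⟩
      n + 1                    ∎)
  SuccForm⇒Zumkeller {n} (leading (suc (suc c)) L _ c+2<p n+1≡) =
    inj₂ (ds , (<-trans (n<1+n (suc c)) c+2<p ∷ replicate⁺ L p∸1<p , (z<s , z<s) , eval≡) ,
          inj₂ (zero , others , inj₁ (refl , z<s , c+1≤p∸2)))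
    where
    open ≡-Reasoning
    ds = suc c ∷ replicate L (p ∸ 1)
    c+1≤p∸2 : suc c ≤ p ∸ 2
    c+1≤p∸2 = ∸-monoˡ-≤ 2 c+2<p
    others : ∀ k → k ≢ zero → lookup ds k ≡ p ∸ 1
    others zero    k≢0 = contradiction refl k≢0
    others (suc k) _   = lookup-replicate′ L (p ∸ 1) k
    eval≡ : evalDigits p ds ≡ n
    eval≡ = +-cancelʳ-≡ 1 _ _ (begin
      evalDigits p ds + 1
        ≡⟨ cong (_+ 1) (evalDigits-∷ (suc c) (replicate L (p ∸ 1))) ⟩
      suc c * P′ + evalDigits p (replicate L (p ∸ 1)) + 1 ≡⟨ +-assoc (suc c * P′) _ 1 ⟩
      suc c * P′ + (evalDigits p (replicate L (p ∸ 1)) + 1)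
        ≡⟨ cong (suc c * P′ +_) (evalDigits-max (replicate L (p ∸ 1)) (lookup-replicate′ L (p ∸ 1))) ⟩
      suc c * P′ + P′
        ≡⟨ +-comm (suc c * P′) P′ ⟩
      suc (suc c) * P′
        ≡⟨ cong (λ l → suc (suc c) * p ^ l) (length-replicate L) ⟩
      suc (suc c) * p ^ L
        ≡⟨ n+1≡ ⟨
      suc n
        ≡⟨ +-comm 1 n ⟩
      n + 1
        ∎)
      where P′ = p ^ length (replicate L (p ∸ 1))
  SuccForm⇒Zumkeller (repdigit zero _ () _)
  SuccForm⇒Zumkeller {n} (repdigit M@(suc _) j _ n+1+p^j≡) =
    inj₂ (maxWithDip M j , (maxWithDip<p M j , (z<s , p∸1≥1) , eval≡) ,
          inj₂ (i , lookup-maxWithDip M j , inj₂ (subst (1 ≤_) (sym (toℕ-dipIndex M j)) z<s , lookup-dipIndex M j)))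
    where
    open ≡-Reasoning
    i = dipIndex M j
    eval≡ : evalDigits p (maxWithDip M j) ≡ n
    eval≡ = +-cancelʳ-≡ (suc (p ^ j)) _ _ (begin
      evalDigits p (maxWithDip M j) + suc (p ^ j)
        ≡⟨ cong (λ l → evalDigits p (maxWithDip M j) + suc (p ^ l)) (begin
             j
               ≡⟨ m+n∸m≡n (suc M) j ⟨
             suc M + j ∸ suc M
               ≡⟨ cong₂ (λ l t → l ∸ suc t) (length-maxWithDip M j) (toℕ-dipIndex M j) ⟨
             length (maxWithDip M j) ∸ suc (toℕ i)
               ∎) ⟩
      evalDigits p (maxWithDip M j) + suc (p ^ (length (maxWithDip M j) ∸ suc (toℕ i)))
        ≡⟨ evalDigits-dip (maxWithDip M j) i (lookup-maxWithDip M j) (lookup-dipIndex M j) ⟩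
      p ^ length (maxWithDip M j)              ≡⟨ cong (p ^_) (length-maxWithDip M j) ⟩
      p ^ (suc M + j)                          ≡⟨ ^-distribˡ-+-* p (suc M) j ⟩
      p ^ suc M * p ^ j                        ≡⟨ n+1+p^j≡ ⟨
      suc n + p ^ j                            ≡⟨ +-suc n (p ^ j) ⟨
      n + suc (p ^ j)                          ∎)

theorem1 : (p : ℕ) → Prime p → (n : ℕ) → BinomialPredictor p n ⇔ Zumkeller p n
theorem1 p p-prime n = mk⇔
  (SuccForm⇒Zumkeller p p-prime ∘ predictor⇒SuccForm p p-prime)
  (SuccForm⇒predictor p p-prime ∘ Zumkeller⇒SuccForm p p-prime)
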